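{- Let $V:\mathsf{FOR}\to U$ be the map defined on atoms by $V(p)=u$, where $u\in\mathsf{ML}_{\mathcal{B}}$ is such that $w\sim u$ for some $w\in\mathsf{L}_{\mathcal{B}}$ with $w:p$ on $\mathcal{B}$, if such $w$ exists, and $V(p)=\mathbf{w}^+$ otherwise, and extended by $V(\neg\psi)=\tilde\neg V(\psi)$, $V(\psi\to\theta)=V(\psi)\tilde\to V(\theta)$, $V(\psi\equiv\theta)=V(\psi)\tilde\equiv V(\theta)$, with the operations of the branch model $\mathcal{M}_{\mathcal{B}}$ defined in the context. Then for all $\psi\in\mathsf{FOR}$ and $w\in\mathsf{L}_{\mathcal{B}}$: if $w:\psi$ occurs on $\mathcal{B}$, then $w\sim V(\psi)$.
   Context: SCI-formulas: over a countably infinite set $\mathsf{AF}$ of atoms, $\varphi ::= p \mid \neg\varphi \mid \varphi\to\varphi \mid \varphi\equiv\varphi$; $\mathsf{FOR}$ is the set of formulas. Tableau system $\mathsf{TC}_{\mathsf{SCI}}$. Let $\mathsf{L}^+,\mathsf{L}^-$ be disjoint countably infinite sets of labels, $\mathsf{L}=\mathsf{L}^+\cup\mathsf{L}^-$; a label written $w^+$ lies in $\mathsf{L}^+$, $w^-$ in $\mathsf{L}^-$, unsuperscripted labels are arbitrary. A labelled formula is $w:\varphi$; equality statements $w=v$ and inequality statements $w\neq v$ may also occur. A tableau is a tree whose nodes carry these items or $\bot$; a branch is a root-to-leaf path identified with its set of items. Rules (premises / alternative conclusion sets separated by $\mid$): decomposition rules (conclusion labels fresh on the branch): $(\neg^+)$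 $w^+:\neg\varphi$ / $v^-:\varphi$; $(\neg^-)$ $w^-:\neg\varphi$ / $v^+:\varphi$; $(\to^+)$ $w^+:\varphi\to\psi$ / $\{v^-:\varphi,u^-:\psi\}\mid\{v^-:\varphi,u^+:\psi\}\mid\{v^+:\varphi,u^+:\psi\}$; $(\to^-)$ $w^-:\varphi\to\psi$ / $\{v^+:\varphi,u^-:\psi\}$; $(\equiv^+)$ $w^+:\varphi\equiv\psi$ / $\{v^+:\varphi,u^+:\psi,v^+=u^+\}\mid\{v^-:\varphi,u^-:\psi,v^-=u^-\}$; $(\equiv^-)$ $w^-:\varphi\equiv\psi$ / $\{v^+:\varphi,u^+:\psi,v^+\neq u^+\}\mid\{v^+:\varphi,u^-:\psi\}\mid\{v^-:\varphi,u^+:\psi\}\mid\{v^-:\varphi,u^-:\psi,v^-\neq u^-\}$. Equality rules, with $\varphi\approx\psi$ abbreviating premises $w:\varphi$, $v:\psi$, $w=v$: $(\equiv^\neg)$ $\varphi\approx\psi$, $u:\neg\varphi$, $y:\neg\psi$ / $u=y$; $(\equiv^\to)$ $\varphi\approx\psi$, $\chi\approx\theta$, $x:\varphi\to\chi$, $z:\psi\to\theta$ / $x=z$; $(\equiv^\equiv)$ $\varphi\approx\psi$, $\chi\approx\theta$, $x:\varphi\equiv\chi$, $z:\psi\equiv\theta$ / $x=z$; $(\mathsf F)$ $w:\varphi$, $v:\varphi$ / $w=v$; $(\mathsf{sym})$ $w=v$ / $v=w$; $(\mathsf{tran})$ $w=v$, $v=u$ / $w=u$. Closure rules: $(\bot_1)$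 $w=v$, $w\neq v$ / $\bot$; $(\bot_2)$ $w^+=v^-$ / $\bot$. A decomposition rule may be applied to $w:\varphi$ on a branch only once; an equality rule only if its conclusion is not yet on the branch; closure rules are applied eagerly. A branch is closed if a closure rule was applied on it, open otherwise; fully expanded if closed or no rule is applicable. Branch model. Let $\varphi\in\mathsf{FOR}$, $\mathbf{w}^-\in\mathsf{L}^-$, and $\mathcal{B}$ an open fully expanded branch of a tableau with root $\mathbf{w}^-:\varphi$. $\mathsf{L}_{\mathcal{B}}$ is the set of labels $w$ with $w:\psi$ on $\mathcal{B}$ for some $\psi$; $\mathsf{L}_{\mathcal{B}}^\pm=\mathsf{L}_{\mathcal{B}}\cap\mathsf{L}^\pm$; $w\sim v$ iff $w=v$ occurs on $\mathcal{B}$ (an equivalence relation on $\mathsf{L}_{\mathcal{B}}$). $\mathsf{ML}_{\mathcal{B}}^+$ contains exactly one label from each $\sim$-class of $\mathsf{L}_{\mathcal{B}}^+$; $\mathsf{ML}_{\mathcal{B}}^-$ exactly one from each $\sim$-class of $\mathsf{L}_{\mathcal{B}}^-$, with $\mathbf{w}^-\in\mathsf{ML}_{\mathcal{B}}^-$; $\mathsf{ML}_{\mathcal{B}}=\mathsf{ML}_{\mathcal{B}}^+\cup\mathsf{ML}_{\mathcal{B}}^-$. Let $\mathbf{w}^+$ be an object not in $\mathsf{L}_{\mathcal{B}}$; for $w\in U$ and a label $t$, "$w\sim t$" is false if $w=\mathbf{w}^+$. $w\in\mathsf{ML}_{\mathcal{B}}$ is $(\neg)$-closed if there are $\psi$,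 $u\in\mathsf{ML}_{\mathcal{B}}$, $v,t\in\mathsf{L}_{\mathcal{B}}$ with $w\sim v$, $u\sim t$, and $v:\psi$, $t:\neg\psi$ on $\mathcal{B}$. For $\#\in\{\to,\equiv\}$, $(w,v)\in\mathsf{ML}_{\mathcal{B}}^2$ is $(\#)$-closed if there are $\psi,\theta$, $u\in\mathsf{ML}_{\mathcal{B}}$, $t,x,y\in\mathsf{L}_{\mathcal{B}}$ with $w\sim t$, $v\sim x$, $u\sim y$ and $t:\psi$, $x:\theta$, $y:(\psi\#\theta)$ on $\mathcal{B}$ ($\mathbf{w}^+$ and pairs involving it are never closed). $D=\mathsf{ML}_{\mathcal{B}}^+\cup\{\mathbf{w}^+\}$, $U=D\cup\mathsf{ML}_{\mathcal{B}}^-$. For $w,v\in U$: $\tilde\neg w=u\in\mathsf{ML}_{\mathcal{B}}$ if there are $\psi$ and $v',t\in\mathsf{L}_{\mathcal{B}}$ with $w\sim v'$, $u\sim t$, $v':\psi$, $t:\neg\psi$ on $\mathcal{B}$; $=\mathbf{w}^+$ if $w$ is not $(\neg)$-closed and $w\notin D$; $=\mathbf{w}^-$ otherwise. $w\tilde\to v=u\in\mathsf{ML}_{\mathcal{B}}$ if there are $\psi,\theta$, $t,x,y\in\mathsf{L}_{\mathcal{B}}$ with $w\sim t$, $v\sim x$, $u\sim y$, $t:\psi$, $x:\theta$, $y:(\psi\to\theta)$ on $\mathcal{B}$; $=\mathbf{w}^+$ if $v=\mathbf{w}^+$, or ($w=\mathbf{w}^+$ and $v\in D$), or ($(w,v)$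 not $(\to)$-closed and ($w\notin D$ or $v\in D$)); $=\mathbf{w}^-$ otherwise. $w\tilde\equiv v=u\in\mathsf{ML}_{\mathcal{B}}$ if there are $\psi,\theta$, $t,x,y\in\mathsf{L}_{\mathcal{B}}$ with $w\sim t$, $v\sim x$, $u\sim y$, $t:\psi$, $x:\theta$, $y:(\psi\equiv\theta)$ on $\mathcal{B}$; $=\mathbf{w}^+$ if $w=v$ and ($w=\mathbf{w}^+$ or $(w,v)$ not $(\equiv)$-closed); $=\mathbf{w}^-$ otherwise. $\mathcal{M}_{\mathcal{B}}=\langle U,D,\tilde\neg,\tilde\to,\tilde\equiv\rangle$. -}

module Defs where

open import Data.Nat using (ℕ)
open import Data.Product using (Σ; ∃; ∃-syntax; _×_; _,_; proj₁; proj₂)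
open import Data.Sum using (_⊎_)
open import Data.Unit using (⊤)
open import Data.Empty using (⊥)
open import Data.List using (List; []; _∷_; _++_; [_])
open import Data.List.Membership.Propositional using (_∈_; _∉_)
open import Data.List.Relation.Unary.Any using (Any)
open import Relation.Nullary using (¬_)
open import Relation.Binary.PropositionalEquality using (_≡_; _≢_)
open import Relation.Binary.Construct.Closure.ReflexiveTransitive using (Star)

infixr 8 _⇒_
infix 8 _≣_

data Formula : Set where
  at  : ℕ → Formula
  ~_  : Formula → Formula
  _⇒_ : Formula → Formula → Formula
  _≣_ : Formula → Formula → Formula

-- Labels: L = L⁺ ∪ L⁻, two disjoint countably infinite sets.
-- A label is a polarity together with an index.

data Sign : Set where
  pos neg : Sign

Label : Set
Label = Sign × ℕ

sign : Label → Sign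
sign = proj₁

data Item : Set where
  _∶_  : Label → Formula → Item
  _≐_  : Label → Label → Item
  _≠_  : Label → Label → Item
  bot  : Item

infix 6 _∶_ _≐_ _≠_

labelsOf : Item → List Label
labelsOf (w ∶ _) = [ w ]
labelsOf (w ≐ v) = w ∷ v ∷ []
labelsOf (w ≠ v) = w ∷ v ∷ []
labelsOf bot     = []

Fresh : Label → List Item → Set
Fresh v B = ¬ Any (λ i → v ∈ labelsOf i) B

-- Decomposition rules: Decomp B w φ C  means that applying the
-- decomposition rule to  w : φ  on branch B may yield conclusion set C
-- (with labels fresh on B; the two conclusion labels are distinct).

data Decomp (B : List Item) : Label → Formula → List Item → Set where
  d¬⁺  : ∀ {n i φ} → Fresh (neg , i) B →
         Decomp B (pos , n) (~ φ) [ (neg , i) ∶ φ ]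
  d¬⁻  : ∀ {n i φ} → Fresh (pos , i) B →
         Decomp B (neg , n) (~ φ) [ (pos , i) ∶ φ ]
  d⇒⁺₁ : ∀ {n i j φ ψ} → Fresh (neg , i) B → Fresh (neg , j) B → i ≢ j →
         Decomp B (pos , n) (φ ⇒ ψ) ((neg , i) ∶ φ ∷ (neg , j) ∶ ψ ∷ [])
  d⇒⁺₂ : ∀ {n i j φ ψ} → Fresh (neg , i) B → Fresh (pos , j) B →
         Decomp B (pos , n) (φ ⇒ ψ) ((neg , i) ∶ φ ∷ (pos , j) ∶ ψ ∷ [])
  d⇒⁺₃ : ∀ {n i j φ ψ} → Fresh (pos , i) B → Fresh (pos , j) B → i ≢ j →
         Decomp B (pos , n) (φ ⇒ ψ) ((pos , i) ∶ φ ∷ (pos , j) ∶ ψ ∷ [])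
  d⇒⁻  : ∀ {n i j φ ψ} → Fresh (pos , i) B → Fresh (neg , j) B →
         Decomp B (neg , n) (φ ⇒ ψ) ((pos , i) ∶ φ ∷ (neg , j) ∶ ψ ∷ [])
  d≣⁺₁ : ∀ {n i j φ ψ} → Fresh (pos , i) B → Fresh (pos , j) B → i ≢ j →
         Decomp B (pos , n) (φ ≣ ψ)
           ((pos , i) ∶ φ ∷ (pos , j) ∶ ψ ∷ ((pos , i) ≐ (pos , j)) ∷ [])
  d≣⁺₂ : ∀ {n i j φ ψ} → Fresh (neg , i) B → Fresh (neg , j) B → i ≢ j →
         Decomp B (pos , n) (φ ≣ ψ)
           ((neg , i) ∶ φ ∷ (neg , j) ∶ ψ ∷ ((neg , i) ≐ (neg , j)) ∷ [])
  d≣⁻₁ : ∀ {n i j φ ψ} → Fresh (pos , i) B → Fresh (pos , j) B → i ≢ j →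
         Decomp B (neg , n) (φ ≣ ψ)
           ((pos , i) ∶ φ ∷ (pos , j) ∶ ψ ∷ ((pos , i) ≠ (pos , j)) ∷ [])
  d≣⁻₂ : ∀ {n i j φ ψ} → Fresh (pos , i) B → Fresh (neg , j) B →
         Decomp B (neg , n) (φ ≣ ψ) ((pos , i) ∶ φ ∷ (neg , j) ∶ ψ ∷ [])
  d≣⁻₃ : ∀ {n i j φ ψ} → Fresh (neg , i) B → Fresh (pos , j) B →
         Decomp B (neg , n) (φ ≣ ψ) ((neg , i) ∶ φ ∷ (pos , j) ∶ ψ ∷ [])
  d≣⁻₄ : ∀ {n i j φ ψ} → Fresh (neg , i) B → Fresh (neg , j) B → i ≢ j →
         Decomp B (neg , n) (φ ≣ ψ)
           ((neg , i) ∶ φ ∷ (neg , j) ∶ ψ ∷ ((neg , i) ≠ (neg , j)) ∷ [])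

_≈_on_ : Formula → Formula → List Item → Set
φ ≈ ψ on B = ∃[ w ] ∃[ v ] ((w ∶ φ) ∈ B × (v ∶ ψ) ∈ B × (w ≐ v) ∈ B)

data EqR (B : List Item) : Item → Set where
  e¬    : ∀ {φ ψ u y} → φ ≈ ψ on B → (u ∶ ~ φ) ∈ B → (y ∶ ~ ψ) ∈ B →
          EqR B (u ≐ y)
  e⇒    : ∀ {φ ψ χ θ x z} → φ ≈ ψ on B → χ ≈ θ on B →
          (x ∶ (φ ⇒ χ)) ∈ B → (z ∶ (ψ ⇒ θ)) ∈ B → EqR B (x ≐ z)
  e≣    : ∀ {φ ψ χ θ x z} → φ ≈ ψ on B → χ ≈ θ on B →
          (x ∶ (φ ≣ χ)) ∈ B → (z ∶ (ψ ≣ θ)) ∈ B → EqR B (x ≐ z)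
  eF    : ∀ {φ w v} → (w ∶ φ) ∈ B → (v ∶ φ) ∈ B → EqR B (w ≐ v)
  esym  : ∀ {w v} → (w ≐ v) ∈ B → EqR B (v ≐ w)
  etran : ∀ {w v u} → (w ≐ v) ∈ B → (v ≐ u) ∈ B → EqR B (w ≐ u)

data ClR (B : List Item) : Set where
  c⊥₁ : ∀ {w v} → (w ≐ v) ∈ B → (w ≠ v) ∈ B → ClR B
  c⊥₂ : ∀ {i j} → ((pos , i) ≐ (neg , j)) ∈ B → ClR B

-- Branches under construction: the items of the branch together with the
-- labelled formulas to which a decomposition rule was already applied.

record BranchSt : Set where
  constructor st
  field
    items : List Item
    used  : List (Label × Formula)
open BranchSt public

data Step : BranchSt → BranchSt → Set where
  sdec : ∀ {B U w φ C} → (w ∶ φ) ∈ B → (w , φ) ∉ U → Decomp B w φ C →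
         Step (st B U) (st (B ++ C) ((w , φ) ∷ U))
  seq  : ∀ {B U c} → EqR B c → c ∉ B → Step (st B U) (st (B ++ [ c ]) U)
  scl  : ∀ {B U} → ClR B → bot ∉ B → Step (st B U) (st (B ++ [ bot ]) U)

IsBranchOf : Item → BranchSt → Set
IsBranchOf r s = Star Step (st [ r ] []) s

Closed Open : BranchSt → Set
Closed s = bot ∈ items s
Open s = ¬ Closed s

FullyExpanded : BranchSt → Set
FullyExpanded s = Closed s ⊎ (∀ s' → ¬ Step s s')

-- Branch model.  B : items of the branch, ML : the chosen set of
-- representatives (ML = ML⁺ ∪ ML⁻), wm : the root label 𝐰⁻.

InL : List Item → Label → Set
InL B w = ∃[ ψ ] ((w ∶ ψ) ∈ B)

_∼⟨_⟩_ : Label → List Item → Label → Set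
w ∼⟨ B ⟩ v = (w ≐ v) ∈ B

record IsML (B : List Item) (wm : Label) (ML : Label → Set) : Set where
  field
    sub    : ∀ u → ML u → InL B u
    cover  : ∀ w → InL B w → ∃[ u ] (ML u × sign u ≡ sign w × w ∼⟨ B ⟩ u)
    unique : ∀ u u' → ML u → ML u' → sign u ≡ sign u' → u ∼⟨ B ⟩ u' → u ≡ u'
    root   : ML wm

-- Elements of the universe U = ML⁺ ∪ {𝐰⁺} ∪ ML⁻ (𝐰⁺ is a new object).
data UEl : Set where
  w⁺  : UEl
  lab : Label → UEl

module Model (B : List Item) (ML : Label → Set) (wm : Label) where

  _∼U_ : UEl → Label → Set
  w⁺ ∼U t = ⊥
  lab w ∼U t = w ∼⟨ B ⟩ t

  _∼L_ : Label → UEl → Set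
  t ∼L w⁺ = ⊥
  t ∼L lab w = t ∼⟨ B ⟩ w

  InD : UEl → Set
  InD w⁺ = ⊤
  InD (lab u) = ML u × sign u ≡ pos

  NegClosed : UEl → Set
  NegClosed a = ∃[ ψ ] ∃[ u ] ∃[ v ] ∃[ t ]
    (ML u × a ∼U v × u ∼⟨ B ⟩ t × (v ∶ ψ) ∈ B × (t ∶ ~ ψ) ∈ B)

  ImpClosed : UEl → UEl → Set
  ImpClosed a b = ∃[ ψ ] ∃[ θ ] ∃[ u ] ∃[ t ] ∃[ x ] ∃[ y ]
    (ML u × a ∼U t × b ∼U x × u ∼⟨ B ⟩ y ×
     (t ∶ ψ) ∈ B × (x ∶ θ) ∈ B × (y ∶ (ψ ⇒ θ)) ∈ B)

  EqvClosed : UEl → UEl → Set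
  EqvClosed a b = ∃[ ψ ] ∃[ θ ] ∃[ u ] ∃[ t ] ∃[ x ] ∃[ y ]
    (ML u × a ∼U t × b ∼U x × u ∼⟨ B ⟩ y ×
     (t ∶ ψ) ∈ B × (x ∶ θ) ∈ B × (y ∶ (ψ ≣ θ)) ∈ B)

  NegCase : UEl → Label → Set
  NegCase a u = ML u × ∃[ ψ ] ∃[ v' ] ∃[ t ]
    (a ∼U v' × u ∼⟨ B ⟩ t × (v' ∶ ψ) ∈ B × (t ∶ ~ ψ) ∈ B)

  ImpCase : UEl → UEl → Label → Set
  ImpCase a b u = ML u × ∃[ ψ ] ∃[ θ ] ∃[ t ] ∃[ x ] ∃[ y ]
    (a ∼U t × b ∼U x × u ∼⟨ B ⟩ y ×
     (t ∶ ψ) ∈ B × (x ∶ θ) ∈ B × (y ∶ (ψ ⇒ θ)) ∈ B)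

  EqvCase : UEl → UEl → Label → Set
  EqvCase a b u = ML u × ∃[ ψ ] ∃[ θ ] ∃[ t ] ∃[ x ] ∃[ y ]
    (a ∼U t × b ∼U x × u ∼⟨ B ⟩ y ×
     (t ∶ ψ) ∈ B × (x ∶ θ) ∈ B × (y ∶ (ψ ≣ θ)) ∈ B)

  NegPlus : UEl → Set
  NegPlus a = ¬ NegClosed a × ¬ InD a

  ImpPlus : UEl → UEl → Set
  ImpPlus a b = b ≡ w⁺ ⊎ (a ≡ w⁺ × InD b)
              ⊎ (¬ ImpClosed a b × (¬ InD a ⊎ InD b))

  EqvPlus : UEl → UEl → Set
  EqvPlus a b = a ≡ b × (a ≡ w⁺ ⊎ ¬ EqvClosed a b)

  -- graphs of the operations ¬̃, →̃, ≡̃ (clauses tried in order)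
  data NegR (a : UEl) : UEl → Set where
    n₁ : ∀ {u} → NegCase a u → NegR a (lab u)
    n₂ : (∀ u → ¬ NegCase a u) → NegPlus a → NegR a w⁺
    n₃ : (∀ u → ¬ NegCase a u) → ¬ NegPlus a → NegR a (lab wm)

  data ImpR (a b : UEl) : UEl → Set where
    i₁ : ∀ {u} → ImpCase a b u → ImpR a b (lab u)
    i₂ : (∀ u → ¬ ImpCase a b u) → ImpPlus a b → ImpR a b w⁺
    i₃ : (∀ u → ¬ ImpCase a b u) → ¬ ImpPlus a b → ImpR a b (lab wm)

  data EqvR (a b : UEl) : UEl → Set where
    q₁ : ∀ {u} → EqvCase a b u → EqvR a b (lab u)
    q₂ : (∀ u → ¬ EqvCase a b u) → EqvPlus a b → EqvR a b w⁺
    q₃ : (∀ u → ¬ EqvCase a b u) → ¬ EqvPlus a b → EqvR a b (lab wm)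

  data Val : Formula → UEl → Set where
    vat₁ : ∀ {p u w} → ML u → (w ∶ at p) ∈ B → w ∼⟨ B ⟩ u → Val (at p) (lab u)
    vat₂ : ∀ {p} → ¬ (∃[ w ] ((w ∶ at p) ∈ B)) → Val (at p) w⁺
    v¬   : ∀ {ψ a x} → Val ψ a → NegR a x → Val (~ ψ) x
    v⇒   : ∀ {ψ θ a b x} → Val ψ a → Val θ b → ImpR a b x → Val (ψ ⇒ θ) x
    v≣   : ∀ {ψ θ a b x} → Val ψ a → Val θ b → EqvR a b x → Val (ψ ≣ θ) x

{-# OPTIONS --safe #-}
module Submission where

open import Defs
open import Data.Nat using (ℕ; suc; _<_; _≟_)
open import Data.Nat.Properties using (<⇒≱; ≤-refl; n≤1+n; 1+n≢n)
open import Data.Product using (∃-syntax; _×_; _,_; proj₂; uncurry)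
open import Data.Product.Properties using (≡-dec)
open import Data.Sum using (_⊎_; inj₁; inj₂)
open import Data.Unit using (⊤; tt)
open import Data.Empty using (⊥-elim)
open import Data.List using (List; map; concatMap)
open import Data.List.Extrema.Nat using (max; xs≤max)
open import Data.List.Membership.Propositional using (_∈_)
open import Data.List.Membership.Propositional.Properties using (∈-map⁺; ∈-concatMap⁺)
import Data.List.Membership.DecPropositional as DecMembership
open import Data.List.Relation.Binary.Subset.Propositional using (_⊆_)
open import Data.List.Relation.Binary.Subset.Propositional.Properties using (xs⊆xs++ys; xs⊆ys++xs)
open import Data.List.Relation.Unary.All as All using ()
open import Data.List.Relation.Unary.Any using (here; there)
open import Relation.Nullary using (¬_; yes; no)
open import Relation.Nullary.Decidable using (map′; _×-dec_; decidable-stable)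
open import Relation.Binary.Definitions using (DecidableEquality)
open import Relation.Binary.PropositionalEquality using (refl; cong; ≢-sym)
open import Relation.Binary.Construct.Closure.ReflexiveTransitive using (Star; ε; _◅_)

-- An open fully expanded branch is closed under the equality
-- rules and, every decomposition rule having been applied, contains labelled
-- copies of the immediate subformulas of each of its formulas; by induction their
-- labels are ∼ the values of those subformulas.  Hence the first clause of the
-- operation of the main connective applies (the representative of the class of
-- w is a witness), and for whichever representative u it selects, the equality
-- rule of that connective gives w ∼ u.  For atoms this is rule (F).

_≟ˢ_ : DecidableEquality Sign
pos ≟ˢ pos = yes refl
pos ≟ˢ neg = no λ ()
neg ≟ˢ pos = no λ ()
neg ≟ˢ neg = yes refl

_≟ᴸ_ : DecidableEquality Label
_≟ᴸ_ = ≡-dec _≟ˢ_ _≟_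

_≟ᶠ_ : DecidableEquality Formula
at p ≟ᶠ at q = map′ (cong at) (λ { refl → refl }) (p ≟ q)
at _ ≟ᶠ (~ _) = no λ ()
at _ ≟ᶠ (_ ⇒ _) = no λ ()
at _ ≟ᶠ (_ ≣ _) = no λ ()
(~ _) ≟ᶠ at _ = no λ ()
(~ φ) ≟ᶠ (~ ψ) = map′ (cong ~_) (λ { refl → refl }) (φ ≟ᶠ ψ)
(~ _) ≟ᶠ (_ ⇒ _) = no λ ()
(~ _) ≟ᶠ (_ ≣ _) = no λ ()
(_ ⇒ _) ≟ᶠ at _ = no λ ()
(_ ⇒ _) ≟ᶠ (~ _) = no λ ()
(φ ⇒ χ) ≟ᶠ (ψ ⇒ θ) =
  map′ (λ { (refl , refl) → refl }) (λ { refl → refl , refl }) (φ ≟ᶠ ψ ×-dec χ ≟ᶠ θ)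
(_ ⇒ _) ≟ᶠ (_ ≣ _) = no λ ()
(_ ≣ _) ≟ᶠ at _ = no λ ()
(_ ≣ _) ≟ᶠ (~ _) = no λ ()
(_ ≣ _) ≟ᶠ (_ ⇒ _) = no λ ()
(φ ≣ χ) ≟ᶠ (ψ ≣ θ) =
  map′ (λ { (refl , refl) → refl }) (λ { refl → refl , refl }) (φ ≟ᶠ ψ ×-dec χ ≟ᶠ θ)

_≟ᴵ_ : DecidableEquality Item
(w ∶ φ) ≟ᴵ (v ∶ ψ) =
  map′ (λ { (refl , refl) → refl }) (λ { refl → refl , refl }) (w ≟ᴸ v ×-dec φ ≟ᶠ ψ)
(_ ∶ _) ≟ᴵ (_ ≐ _) = no λ ()
(_ ∶ _) ≟ᴵ (_ ≠ _) = no λ ()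
(_ ∶ _) ≟ᴵ bot = no λ ()
(_ ≐ _) ≟ᴵ (_ ∶ _) = no λ ()
(w ≐ w') ≟ᴵ (v ≐ v') =
  map′ (λ { (refl , refl) → refl }) (λ { refl → refl , refl }) (w ≟ᴸ v ×-dec w' ≟ᴸ v')
(_ ≐ _) ≟ᴵ (_ ≠ _) = no λ ()
(_ ≐ _) ≟ᴵ bot = no λ ()
(_ ≠ _) ≟ᴵ (_ ∶ _) = no λ ()
(_ ≠ _) ≟ᴵ (_ ≐ _) = no λ ()
(w ≠ w') ≟ᴵ (v ≠ v') =
  map′ (λ { (refl , refl) → refl }) (λ { refl → refl , refl }) (w ≟ᴸ v ×-dec w' ≟ᴸ v')
(_ ≠ _) ≟ᴵ bot = no λ ()
bot ≟ᴵ (_ ∶ _) = no λ ()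
bot ≟ᴵ (_ ≐ _) = no λ ()
bot ≟ᴵ (_ ≠ _) = no λ ()
bot ≟ᴵ bot = yes refl

open DecMembership _≟ᴵ_ using () renaming (_∈?_ to _∈ᴵ?_)
open DecMembership (≡-dec _≟ᴸ_ _≟ᶠ_) using () renaming (_∈?_ to _∈ᵁ?_)

indexBound : List Item → ℕ
indexBound B = max 0 (map proj₂ (concatMap labelsOf B))

fresh-above : ∀ B σ {k} → indexBound B < k → Fresh (σ , k) B
fresh-above B σ bound<k occurs =
  <⇒≱ bound<k (All.lookup (xs≤max 0 _) (∈-map⁺ proj₂ (∈-concatMap⁺ labelsOf occurs)))

fresh-1+ : ∀ B σ → Fresh (σ , suc (indexBound B)) B
fresh-1+ B σ = fresh-above B σ ≤-refl

fresh-2+ : ∀ B σ → Fresh (σ , suc (suc (indexBound B))) B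
fresh-2+ B σ = fresh-above B σ (n≤1+n _)

Occurs : List Item → Formula → Set
Occurs B φ = ∃[ v ] ((v ∶ φ) ∈ B)

ImmediateSubformulasOccur : List Item → Formula → Set
ImmediateSubformulasOccur B (at _) = ⊤
ImmediateSubformulasOccur B (~ φ) = Occurs B φ
ImmediateSubformulasOccur B (φ ⇒ ψ) = Occurs B φ × Occurs B ψ
ImmediateSubformulasOccur B (φ ≣ ψ) = Occurs B φ × Occurs B ψ

occurs-mono : ∀ {B B' φ} → B ⊆ B' → Occurs B φ → Occurs B' φ
occurs-mono B⊆B' (v , vφ) = v , B⊆B' vφ

immediateSubformulas-mono : ∀ {B B'} φ → B ⊆ B' →
  ImmediateSubformulasOccur B φ → ImmediateSubformulasOccur B' φ
immediateSubformulas-mono (at _) _ _ = tt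
immediateSubformulas-mono (~ _) B⊆B' occ = occurs-mono B⊆B' occ
immediateSubformulas-mono (_ ⇒ _) B⊆B' (occ₁ , occ₂) =
  occurs-mono B⊆B' occ₁ , occurs-mono B⊆B' occ₂
immediateSubformulas-mono (_ ≣ _) B⊆B' (occ₁ , occ₂) =
  occurs-mono B⊆B' occ₁ , occurs-mono B⊆B' occ₂

decomp-immediateSubformulas : ∀ {B w φ C} → Decomp B w φ C → ImmediateSubformulasOccur C φ
decomp-immediateSubformulas (d¬⁺ _) = _ , here refl
decomp-immediateSubformulas (d¬⁻ _) = _ , here refl
decomp-immediateSubformulas (d⇒⁺₁ _ _ _) = (_ , here refl) , (_ , there (here refl))
decomp-immediateSubformulas (d⇒⁺₂ _ _) = (_ , here refl) , (_ , there (here refl))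
decomp-immediateSubformulas (d⇒⁺₃ _ _ _) = (_ , here refl) , (_ , there (here refl))
decomp-immediateSubformulas (d⇒⁻ _ _) = (_ , here refl) , (_ , there (here refl))
decomp-immediateSubformulas (d≣⁺₁ _ _ _) = (_ , here refl) , (_ , there (here refl))
decomp-immediateSubformulas (d≣⁺₂ _ _ _) = (_ , here refl) , (_ , there (here refl))
decomp-immediateSubformulas (d≣⁻₁ _ _ _) = (_ , here refl) , (_ , there (here refl))
decomp-immediateSubformulas (d≣⁻₂ _ _) = (_ , here refl) , (_ , there (here refl))
decomp-immediateSubformulas (d≣⁻₃ _ _) = (_ , here refl) , (_ , there (here refl))
decomp-immediateSubformulas (d≣⁻₄ _ _ _) = (_ , here refl) , (_ , there (here refl))

atomic-or-decomposable : ∀ B w φ → ImmediateSubformulasOccur B φ ⊎ ∃[ C ] Decomp B w φ C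
atomic-or-decomposable B w (at _) = inj₁ tt
atomic-or-decomposable B (pos , _) (~ _) = inj₂ (_ , d¬⁺ (fresh-1+ B neg))
atomic-or-decomposable B (neg , _) (~ _) = inj₂ (_ , d¬⁻ (fresh-1+ B pos))
atomic-or-decomposable B (pos , _) (_ ⇒ _) =
  inj₂ (_ , d⇒⁺₁ (fresh-1+ B neg) (fresh-2+ B neg) (≢-sym 1+n≢n))
atomic-or-decomposable B (neg , _) (_ ⇒ _) = inj₂ (_ , d⇒⁻ (fresh-1+ B pos) (fresh-2+ B neg))
atomic-or-decomposable B (pos , _) (_ ≣ _) =
  inj₂ (_ , d≣⁺₁ (fresh-1+ B pos) (fresh-2+ B pos) (≢-sym 1+n≢n))
atomic-or-decomposable B (neg , _) (_ ≣ _) = inj₂ (_ , d≣⁻₂ (fresh-1+ B pos) (fresh-2+ B neg))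

UsedDecomposed : BranchSt → Set
UsedDecomposed s = ∀ {w φ} → (w , φ) ∈ used s → ImmediateSubformulasOccur (items s) φ

step-usedDecomposed : ∀ {s s'} → Step s s' → UsedDecomposed s → UsedDecomposed s'
step-usedDecomposed {st B _} (sdec {φ = φ} _ _ d) _ (here refl) =
  immediateSubformulas-mono φ (xs⊆ys++xs _ B) (decomp-immediateSubformulas d)
step-usedDecomposed (sdec _ _ _) inv {φ = φ} (there p) =
  immediateSubformulas-mono φ (xs⊆xs++ys _ _) (inv p)
step-usedDecomposed (seq _ _) inv {φ = φ} p =
  immediateSubformulas-mono φ (xs⊆xs++ys _ _) (inv p)
step-usedDecomposed (scl _ _) inv {φ = φ} p =
  immediateSubformulas-mono φ (xs⊆xs++ys _ _) (inv p)

branch-usedDecomposed : ∀ {r s} → IsBranchOf r s → UsedDecomposed s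
branch-usedDecomposed = go λ ()
  where
  go : ∀ {s s'} → UsedDecomposed s → Star Step s s' → UsedDecomposed s'
  go inv ε = inv
  go inv (step ◅ steps) = go (step-usedDecomposed step inv) steps

Terminal : BranchSt → Set
Terminal s = ∀ s' → ¬ Step s s'

EqualityClosed : List Item → Set
EqualityClosed B = ∀ {c} → EqR B c → c ∈ B

SubformulaClosed : List Item → Set
SubformulaClosed B = ∀ {w φ} → (w ∶ φ) ∈ B → ImmediateSubformulasOccur B φ

terminal⇒equalityClosed : ∀ {B U} → Terminal (st B U) → EqualityClosed B
terminal⇒equalityClosed {B} stuck {c} rule =
  decidable-stable (c ∈ᴵ? B) λ c∉B → stuck _ (seq rule c∉B)

terminal⇒subformulaClosed : ∀ {B U} → UsedDecomposed (st B U) → Terminal (st B U) →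
  SubformulaClosed B
terminal⇒subformulaClosed {B} {U} inv stuck {w} {φ} wφ with atomic-or-decomposable B w φ
... | inj₁ occ = occ
... | inj₂ (_ , d) =
  inv (decidable-stable ((w , φ) ∈ᵁ? U) λ unused → stuck _ (sdec wφ unused d))

module BranchValuation (B : List Item) (ML : Label → Set) (wm : Label)
  (eq-closed : EqualityClosed B) (sub-closed : SubformulaClosed B) (isML : IsML B wm ML) where
  open Model B ML wm
  open IsML isML

  ∼-sym : ∀ {w v} → w ∼⟨ B ⟩ v → v ∼⟨ B ⟩ w
  ∼-sym w∼v = eq-closed (esym w∼v)

  ∼-trans : ∀ {w v u} → w ∼⟨ B ⟩ v → v ∼⟨ B ⟩ u → w ∼⟨ B ⟩ u
  ∼-trans w∼v v∼u = eq-closed (etran w∼v v∼u)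

  -- ImpCase and EqvCase are BinaryCase _⇒_ and BinaryCase _≣_ by definition.
  BinaryCase : (Formula → Formula → Formula) → UEl → UEl → Label → Set
  BinaryCase _#_ a b u = ML u × ∃[ ψ ] ∃[ θ ] ∃[ t ] ∃[ x ] ∃[ y ]
    (a ∼U t × b ∼U x × u ∼⟨ B ⟩ y × (t ∶ ψ) ∈ B × (x ∶ θ) ∈ B × (y ∶ (ψ # θ)) ∈ B)

  Congruent : (Formula → Formula → Formula) → Set
  Congruent _#_ = ∀ {φ ψ χ θ x z} → φ ≈ ψ on B → χ ≈ θ on B →
    (x ∶ (φ # χ)) ∈ B → (z ∶ (ψ # θ)) ∈ B → x ∼⟨ B ⟩ z

  negCase-∼ : ∀ {w v χ a u} → (w ∶ ~ χ) ∈ B → (v ∶ χ) ∈ B → v ∼⟨ B ⟩ a →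
    NegCase (lab a) u → w ∼⟨ B ⟩ u
  negCase-∼ wφ vχ v∼a (_ , _ , v' , _ , a∼v' , u∼t , v'ψ , t¬ψ) =
    ∼-trans (eq-closed (e¬ (_ , v' , vχ , v'ψ , ∼-trans v∼a a∼v') wφ t¬ψ)) (∼-sym u∼t)

  negCase-exists : ∀ {w v χ a} → (w ∶ ~ χ) ∈ B → (v ∶ χ) ∈ B → v ∼⟨ B ⟩ a →
    ∃[ u ] NegCase (lab a) u
  negCase-exists {w} wφ vχ v∼a with cover w (_ , wφ)
  ... | u , u∈ML , _ , w∼u = u , u∈ML , _ , _ , w , ∼-sym v∼a , ∼-sym w∼u , vχ , wφ

  binaryCase-∼ : ∀ _#_ → Congruent _#_ → ∀ {w t x χ θ a b u} → (w ∶ (χ # θ)) ∈ B →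
    (t ∶ χ) ∈ B → (x ∶ θ) ∈ B → t ∼⟨ B ⟩ a → x ∼⟨ B ⟩ b →
    BinaryCase _#_ (lab a) (lab b) u → w ∼⟨ B ⟩ u
  binaryCase-∼ _ congruent wφ tχ xθ t∼a x∼b
    (_ , _ , _ , t' , x' , _ , a∼t' , b∼x' , u∼y , t'ψ , x'θ , yφ) =
    ∼-trans (congruent (_ , t' , tχ , t'ψ , ∼-trans t∼a a∼t')
                       (_ , x' , xθ , x'θ , ∼-trans x∼b b∼x') wφ yφ)
            (∼-sym u∼y)

  binaryCase-exists : ∀ _#_ {w t x χ θ a b} → (w ∶ (χ # θ)) ∈ B →
    (t ∶ χ) ∈ B → (x ∶ θ) ∈ B → t ∼⟨ B ⟩ a → x ∼⟨ B ⟩ b →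
    ∃[ u ] BinaryCase _#_ (lab a) (lab b) u
  binaryCase-exists _ {w} wφ tχ xθ t∼a x∼b with cover w (_ , wφ)
  ... | u , u∈ML , _ , w∼u =
    u , u∈ML , _ , _ , _ , _ , w , ∼-sym t∼a , ∼-sym x∼b , ∼-sym w∼u , tχ , xθ , wφ

  neg-∼ : ∀ {w v χ a y} → (w ∶ ~ χ) ∈ B → (v ∶ χ) ∈ B → v ∼L a → NegR a y → w ∼L y
  neg-∼ {a = lab _} wφ vχ v∼a (n₁ c) = negCase-∼ wφ vχ v∼a c
  neg-∼ {a = lab _} wφ vχ v∼a (n₂ none _) = uncurry none (negCase-exists wφ vχ v∼a)
  neg-∼ {a = lab _} wφ vχ v∼a (n₃ none _) = ⊥-elim (uncurry none (negCase-exists wφ vχ v∼a))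

  imp-∼ : ∀ {w t x χ θ a b y} → (w ∶ (χ ⇒ θ)) ∈ B → (t ∶ χ) ∈ B → (x ∶ θ) ∈ B →
    t ∼L a → x ∼L b → ImpR a b y → w ∼L y
  imp-∼ {a = lab _} {b = lab _} wφ tχ xθ t∼a x∼b (i₁ c) =
    binaryCase-∼ _⇒_ (λ p q r s → eq-closed (e⇒ p q r s)) wφ tχ xθ t∼a x∼b c
  imp-∼ {a = lab _} {b = lab _} wφ tχ xθ t∼a x∼b (i₂ none _) =
    uncurry none (binaryCase-exists _⇒_ wφ tχ xθ t∼a x∼b)
  imp-∼ {a = lab _} {b = lab _} wφ tχ xθ t∼a x∼b (i₃ none _) =
    ⊥-elim (uncurry none (binaryCase-exists _⇒_ wφ tχ xθ t∼a x∼b))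

  eqv-∼ : ∀ {w t x χ θ a b y} → (w ∶ (χ ≣ θ)) ∈ B → (t ∶ χ) ∈ B → (x ∶ θ) ∈ B →
    t ∼L a → x ∼L b → EqvR a b y → w ∼L y
  eqv-∼ {a = lab _} {b = lab _} wφ tχ xθ t∼a x∼b (q₁ c) =
    binaryCase-∼ _≣_ (λ p q r s → eq-closed (e≣ p q r s)) wφ tχ xθ t∼a x∼b c
  eqv-∼ {a = lab _} {b = lab _} wφ tχ xθ t∼a x∼b (q₂ none _) =
    uncurry none (binaryCase-exists _≣_ wφ tχ xθ t∼a x∼b)
  eqv-∼ {a = lab _} {b = lab _} wφ tχ xθ t∼a x∼b (q₃ none _) =
    ⊥-elim (uncurry none (binaryCase-exists _≣_ wφ tχ xθ t∼a x∼b))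

  val-∼ : ∀ {ψ w x} → (w ∶ ψ) ∈ B → Val ψ x → w ∼L x
  val-∼ wψ (vat₁ _ vψ v∼u) = ∼-trans (eq-closed (eF wψ vψ)) v∼u
  val-∼ wψ (vat₂ none) = none (_ , wψ)
  val-∼ wψ (v¬ va r) with sub-closed wψ
  ... | _ , vχ = neg-∼ wψ vχ (val-∼ vχ va) r
  val-∼ wψ (v⇒ va vb r) with sub-closed wψ
  ... | (_ , tχ) , (_ , xθ) = imp-∼ wψ tχ xθ (val-∼ tχ va) (val-∼ xθ vb) r
  val-∼ wψ (v≣ va vb r) with sub-closed wψ
  ... | (_ , tχ) , (_ , xθ) = eqv-∼ wψ tχ xθ (val-∼ tχ va) (val-∼ xθ vb) r

proposition12 : (φ : Formula) (n : ℕ) (s : BranchSt) →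
    IsBranchOf ((neg , n) ∶ φ) s → Open s → FullyExpanded s →
    (ML : Label → Set) → IsML (items s) (neg , n) ML →
    (ψ : Formula) (w : Label) → (w ∶ ψ) ∈ items s →
    (x : UEl) → Model.Val (items s) ML (neg , n) ψ x →
    Model._∼L_ (items s) ML (neg , n) w x
proposition12 _ _ _ _ isOpen (inj₁ closed) _ _ _ _ _ _ _ = ⊥-elim (isOpen closed)
proposition12 _ n (st B _) branch _ (inj₂ stuck) ML isML _ _ wψ _ val =
  BranchValuation.val-∼ B ML (neg , n)
    (terminal⇒equalityClosed stuck)
    (terminal⇒subformulaClosed (branch-usedDecomposed branch) stuck)
    isML wψ val
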